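{- Let $T_r$ be a tree rooted on $r$ with thinness $k$. The parent of a critical vertex $x \in V(T_r)$ cannot be a $k$-neighbor of $x$.
   Context: A graph $G$ is $k$-thin if there exist a strict total order $\prec$ on $V(G)$ and a partition of $V(G)$ into $k$ classes such that for all $u \prec v \prec w$ with $u,v$ in the same class and $(u,w)\in E(G)$, also $(v,w)\in E(G)$; the thinness $\mathrm{thin}(G)$ is the minimum such $k$. For adjacent vertices $v,u$ of a tree $T$, the dangling tree from $v$ in $u$ is the connected component of $T$ minus the edge $(v,u)$ containing $u$. A neighbor $v$ of $x$ is a $k$-neighbor of $x$ if $v$ has a neighbor $u\neq x$ such that the dangling tree from $v$ in $u$ has thinness at least $k$. In a rooted tree $T_r$ with $\mathrm{thin}(T_r)=k$, a vertex $x$ is critical if exactly two of its children are $k$-neighbors of $x$. -}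

module Defs where

open import Data.Nat using (ℕ; _<_)
open import Data.Fin using (Fin)
open import Data.Bool using (Bool; true)
open import Data.List using (List; []; _∷_; _∷ʳ_; head; length)
open import Data.Maybe using (just)
open import Data.List.Relation.Unary.Linked using (Linked)
open import Data.List.Relation.Unary.Unique.Propositional using (Unique)
open import Data.Product using (Σ; ∃; _×_)
open import Data.Sum using (_⊎_)
open import Data.Unit using (⊤)
open import Relation.Nullary using (¬_)
open import Relation.Binary.PropositionalEquality using (_≡_; _≢_)
open import Relation.Binary.Structures using (IsStrictTotalOrder)

Graph : ℕ → Set
Graph n = Fin n → Fin n → Bool

module _ {n : ℕ} (E : Graph n) where

  Adj : Fin n → Fin n → Set
  Adj u v = E u v ≡ true

  data Reach (R : Fin n → Fin n → Set) (u : Fin n) : Fin n → Set where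
    here : Reach R u u
    step : ∀ {v w} → Reach R u v → R v w → Reach R u w

  IsSimple : Set
  IsSimple = (∀ u v → E u v ≡ E v u) × (∀ u → ¬ Adj u u)

  Connected : Set
  Connected = ∀ u v → Reach Adj u v

  HasCycle : Set
  HasCycle = Σ (Fin n) λ v → Σ (List (Fin n)) λ ws →
    (2 Data.Nat.≤ length ws) × Unique (v ∷ ws) × Linked Adj (v ∷ ws ∷ʳ v)

  IsTree : Set
  IsTree = IsSimple × Connected × ¬ HasCycle

  -- The order is taken on all of Fin n and restricted to S (any strict total
  -- order on S extends to one on Fin n).
  KThin : (Fin n → Set) → ℕ → Set₁
  KThin S k = Σ (Fin n → Fin n → Set) λ _≺_ → IsStrictTotalOrder _≡_ _≺_ ×
    Σ (Fin n → Fin k) λ c → ∀ u v w → S u → S v → S w →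
      u ≺ v → v ≺ w → c u ≡ c v → Adj u w → Adj v w

  ThinGe : (Fin n → Set) → ℕ → Set₁
  ThinGe S k = ∀ j → j < k → ¬ KThin S j

  ThinEq : (Fin n → Set) → ℕ → Set₁
  ThinEq S k = KThin S k × ThinGe S k

  AllV : Fin n → Set
  AllV _ = ⊤

  -- vertex set of the dangling tree from v in u: component of T - (v,u) containing u
  Dangling : Fin n → Fin n → Fin n → Set
  Dangling v u = Reach (λ a b → Adj a b × ¬ (a ≡ v × b ≡ u) × ¬ (a ≡ u × b ≡ v)) u

  KNeighbor : ℕ → Fin n → Fin n → Set₁
  KNeighbor k x v = Adj x v × Σ (Fin n) λ u → Adj v u × u ≢ x × ThinGe (Dangling v u) k

  Parent : Fin n → Fin n → Fin n → Set
  Parent r x p = Σ (List (Fin n)) λ ws →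
    Unique (x ∷ ws ∷ʳ r) × Linked Adj (x ∷ ws ∷ʳ r) × head (ws ∷ʳ r) ≡ just p

  Child : Fin n → Fin n → Fin n → Set
  Child r x c = Parent r c x

  Critical : Fin n → ℕ → Fin n → Set₁
  Critical r k x = Σ (Fin n) λ c₁ → Σ (Fin n) λ c₂ → c₁ ≢ c₂ ×
    Child r x c₁ × KNeighbor k x c₁ × Child r x c₂ × KNeighbor k x c₂ ×
    (∀ c → Child r x c → KNeighbor k x c → c ≡ c₁ ⊎ c ≡ c₂)

{-# OPTIONS --safe #-}
module Submission where

-- If the parent of a critical vertex x were a k-neighbour of x, then x would
-- have three neighbours a₁, a₂, a₃ whose dangling trees Dᵢ (beyond aᵢ, away
-- from x) have thinness at least k.  Fix a consistent order and partition of
-- T into k classes, and let Cᵢ consist of x, the other two aⱼ and their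
-- dangling trees; Cᵢ is connected, disjoint from Dᵢ and sends no edge to Dᵢ.
-- If every vertex v of Dᵢ lay between two vertices of Cᵢ, then v would lie
-- strictly inside an edge pq of Cᵢ, and the class of p would be forbidden
-- both for v and for every earlier vertex of Dᵢ with a neighbour beyond v.
-- Relabelling Dᵢ greedily along the order then merges the k classes into
-- k − 1 consistent ones, contradicting thin(Dᵢ) ≥ k.  So each Dᵢ has a vertex
-- vᵢ that lies before all of Cᵢ or after all of Cᵢ; as vⱼ ∈ Cᵢ for j ≠ i, the
-- middle one of v₁, v₂, v₃ is a contradiction.

open import Defs
open import Data.Nat using (ℕ; zero; suc; _≤_; _<_; z≤n; s≤s; s≤s⁻¹)
import Data.Nat.Properties as ℕ
open import Data.Fin using (Fin; zero; suc; punchOut)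
open import Data.Fin.Properties
  using (_≟_; any?; pigeonhole; punchOut-injective; ¬Fin0)
  renaming (<⇒≢ to <⇒≢ᶠ)
open import Data.Vec.Functional using (updateAt)
open import Data.Vec.Functional.Properties using (updateAt-updates; updateAt-minimal)
open import Data.Bool using (true)
import Data.Bool.Properties as Bool
open import Data.List using ([]; _∷_; last)
open import Data.List.Relation.Unary.Linked as Linked using (Linked; []; [-]; _∷_)
open import Data.List.Relation.Unary.Linked.Properties using (++⁺)
open import Data.List.Relation.Unary.All using (All; []; _∷_)
open import Data.List.Relation.Unary.All.Properties using (¬Any⇒All¬)
open import Data.List.Relation.Unary.AllPairs using ([]; _∷_)
open import Data.List.Relation.Unary.Any using (here; there)
open import Data.List.Relation.Unary.Unique.Propositional using (Unique)
open import Data.List.Membership.Propositional using (_∈_)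
open import Data.List.Membership.Propositional.Properties using (∈-++⁺ʳ)
open import Data.Maybe using (just)
open import Data.Maybe.Relation.Binary.Connected using (just) renaming (Connected to ConnectedMaybe)
open import Data.Product using (∃; ∃₂; _×_; _,_; proj₁; proj₂; swap)
open import Data.Sum using (_⊎_; inj₁; inj₂)
open import Data.Empty using (⊥; ⊥-elim)
open import Data.Unit using (tt)
open import Function using (_∘_; flip; const; case_of_)
open import Function.Bundles using (_⇔_; mk⇔; Equivalence)
open import Function.Definitions using (Injective)
open import Relation.Nullary using (¬_; Dec; yes; no; ¬?)
open import Relation.Nullary.Decidable using (_×-dec_; decidable-stable; ¬¬-excluded-middle)
open import Relation.Unary using (Decidable; _⊆_)
open import Relation.Binary.PropositionalEquality using (_≡_; _≢_; refl; sym; trans; subst)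
open import Relation.Binary.Structures using (IsStrictTotalOrder)
open import Relation.Binary.Definitions using (tri<; tri≈; tri>)

open Equivalence using (to; from)

private
  variable
    n : ℕ

count : ∀ {m} {P : Fin m → Set} → Decidable P → ℕ
count {zero} P? = 0
count {suc m} P? with P? zero
... | yes _ = suc (count (P? ∘ suc))
... | no _ = count (P? ∘ suc)

count≤ : ∀ {m} {P : Fin m → Set} (P? : Decidable P) → count P? ≤ m
count≤ {zero} P? = z≤n
count≤ {suc m} P? with P? zero
... | yes _ = s≤s (count≤ (P? ∘ suc))
... | no _ = ℕ.m≤n⇒m≤1+n (count≤ (P? ∘ suc))

count-mono : ∀ {m} {P Q : Fin m → Set} (P? : Decidable P) (Q? : Decidable Q) →
             P ⊆ Q → count P? ≤ count Q?
count-mono {zero} P? Q? P⊆Q = z≤n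
count-mono {suc m} P? Q? P⊆Q with P? zero | Q? zero
... | yes _ | yes _ = s≤s (count-mono (P? ∘ suc) (Q? ∘ suc) P⊆Q)
... | no _ | yes _ = ℕ.m≤n⇒m≤1+n (count-mono (P? ∘ suc) (Q? ∘ suc) P⊆Q)
... | no _ | no _ = count-mono (P? ∘ suc) (Q? ∘ suc) P⊆Q
... | yes P₀ | no ¬Q₀ = ⊥-elim (¬Q₀ (P⊆Q P₀))

count-< : ∀ {m} {P Q : Fin m → Set} (P? : Decidable P) (Q? : Decidable Q) →
          P ⊆ Q → ∀ {i} → ¬ P i → Q i → count P? < count Q?
count-< {suc m} P? Q? P⊆Q {zero} ¬P₀ Q₀ with P? zero | Q? zero
... | yes P₀ | _ = ⊥-elim (¬P₀ P₀)
... | no _ | yes _ = s≤s (count-mono (P? ∘ suc) (Q? ∘ suc) P⊆Q)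
... | no _ | no ¬Q₀ = ⊥-elim (¬Q₀ Q₀)
count-< {suc m} P? Q? P⊆Q {suc i} ¬Pᵢ Qᵢ with P? zero | Q? zero
... | yes _ | yes _ = s≤s (count-< (P? ∘ suc) (Q? ∘ suc) P⊆Q ¬Pᵢ Qᵢ)
... | no _ | yes _ = ℕ.m≤n⇒m≤1+n (count-< (P? ∘ suc) (Q? ∘ suc) P⊆Q ¬Pᵢ Qᵢ)
... | no _ | no _ = count-< (P? ∘ suc) (Q? ∘ suc) P⊆Q ¬Pᵢ Qᵢ
... | yes P₀ | no ¬Q₀ = ⊥-elim (¬Q₀ (P⊆Q P₀))

¬¬-decidable : ∀ {m} (P : Fin m → Set) → ¬ ¬ Decidable P
¬¬-decidable {zero} P k = k λ ()
¬¬-decidable {suc m} P k =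
  ¬¬-excluded-middle λ P₀? → ¬¬-decidable (P ∘ suc) λ P? → k λ { zero → P₀? ; (suc i) → P? i }

no-injection-avoiding-two : ∀ {k} (g : Fin k → Fin (suc k)) → Injective _≡_ _≡_ g →
  ∀ {a b} → a ≢ b → (∀ i → g i ≢ a) → (∀ i → g i ≢ b) → ⊥
no-injection-avoiding-two {zero} g _ {zero} {zero} a≢b _ _ = a≢b refl
no-injection-avoiding-two {suc k} g g-injective {a} {b} a≢b g≢a g≢b =
  let (i , j , i<j , hᵢ≡hⱼ) = pigeonhole (ℕ.n<1+n k) h in
  <⇒≢ᶠ i<j (g-injective (punchOut-injective (b≢g i) (b≢g j)
                          (punchOut-injective (a′≢g′ i) (a′≢g′ j) hᵢ≡hⱼ)))
  where
  b≢g : ∀ i → b ≢ g i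
  b≢g i = g≢b i ∘ sym

  a′ : Fin (suc k)
  a′ = punchOut (a≢b ∘ sym)

  a′≢g′ : ∀ i → a′ ≢ punchOut (b≢g i)
  a′≢g′ i a′≡g′ᵢ = g≢a i (punchOut-injective (b≢g i) (a≢b ∘ sym) (sym a′≡g′ᵢ))

  h : Fin (suc k) → Fin k
  h i = punchOut (a′≢g′ i)

≡-sym-⇔ : ∀ {A B : Set} {a a′ : A} {b b′ : B} → a ≡ a′ ⇔ b ≡ b′ → a′ ≡ a ⇔ b′ ≡ b
≡-sym-⇔ a⇔b = mk⇔ (sym ∘ to a⇔b ∘ sym) (sym ∘ from a⇔b ∘ sym)

module _ {E : Graph n} {R : Fin n → Fin n → Set} where

  Reach-cons : ∀ {s t u} → R s t → Reach E R t u → Reach E R s u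
  Reach-cons r here = step here r
  Reach-cons r (step w r′) = step (Reach-cons r w) r′

  Reach-trans : ∀ {s t u} → Reach E R s t → Reach E R t u → Reach E R s u
  Reach-trans w here = w
  Reach-trans w (step w′ r) = step (Reach-trans w w′) r

  Reach-reverse : (∀ {s t} → R s t → R t s) → ∀ {s t} → Reach E R s t → Reach E R t s
  Reach-reverse R-sym here = here
  Reach-reverse R-sym (step w r) = Reach-cons (R-sym r) (Reach-reverse R-sym w)

  Reach-map : {S : Fin n → Fin n → Set} → (∀ {s t} → R s t → S s t) →
              ∀ {s t} → Reach E R s t → Reach E S s t
  Reach-map f here = here
  Reach-map f (step w r) = step (Reach-map f w) (f r)

  open import Data.List.Membership.DecPropositional (_≟_ {n}) using (_∈?_)

  private
    suffix-from : ∀ {t ys} → t ∈ ys → Unique ys → Linked (flip R) ys →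
      ∃ λ qs → Unique (t ∷ qs) × Linked (flip R) (t ∷ qs) × last (t ∷ qs) ≡ last ys
    suffix-from {ys = _ ∷ qs} (here refl) distinct path = qs , distinct , path , refl
    suffix-from {ys = _ ∷ []} (there ())
    suffix-from {ys = _ ∷ _ ∷ _} (there t∈) (_ ∷ distinct) (_ ∷ path) =
      suffix-from t∈ distinct path

  loop-erasure : ∀ {s t} → Reach E R s t →
    ∃ λ qs → Unique (t ∷ qs) × Linked (flip R) (t ∷ qs) × last (t ∷ qs) ≡ just s
  loop-erasure here = [] , [] ∷ [] , [-] , refl
  loop-erasure {t = t} (step {t′} w r) with loop-erasure w
  ... | qs , distinct , path , ends with t ∈? t′ ∷ qs
  ... | yes t∈ = let (qs′ , distinct′ , path′ , ends′) = suffix-from t∈ distinct path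
                 in qs′ , distinct′ , path′ , trans ends′ ends
  ... | no t∉ = t′ ∷ qs , ¬Any⇒All¬ _ t∉ ∷ distinct , r ∷ path , ends

module _ (E : Graph n) where

  OffEdge : Fin n → Fin n → Fin n → Fin n → Set
  OffEdge v u s t = Adj E s t × ¬ (s ≡ v × t ≡ u) × ¬ (s ≡ u × t ≡ v)

  Within : (Fin n → Set) → Fin n → Fin n → Set
  Within C s t = Adj E s t × C s × C t

Within-mono : {E : Graph n} {C D : Fin n → Set} → C ⊆ D →
              ∀ {s t} → Within E C s t → Within E D s t
Within-mono C⊆D (s~t , C-s , C-t) = s~t , C⊆D C-s , C⊆D C-t

Reach-inside : {E : Graph n} {R : Fin n → Fin n → Set} → (∀ {s t} → R s t → Adj E s t) →
               ∀ {u t} → Reach E R u t → Reach E (Within E (Reach E R u)) u t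
Reach-inside R⇒Adj here = here
Reach-inside R⇒Adj (step w r) = step (Reach-inside R⇒Adj w) (R⇒Adj r , w , step w r)

-- The data of a k-neighbour a of x except the thinness bound: Hanging is the
-- dangling tree from a in tip.
record Branch (E : Graph n) (x a : Fin n) : Set where
  constructor branch
  field
    tip : Fin n
    x~base : Adj E x a
    base~tip : Adj E a tip
    tip≢x : tip ≢ x

  Hanging : Fin n → Set
  Hanging = Dangling E a tip

  Arm : Fin n → Set
  Arm t = t ≡ x ⊎ t ≡ a ⊎ Hanging t

open Branch

Arms : {E : Graph n} {x a a′ : Fin n} → Branch E x a → Branch E x a′ → Fin n → Set
Arms b b′ t = Arm b t ⊎ Arm b′ t

module Tree {n : ℕ} {E : Graph n} (tree : IsTree E) where

  Adj-sym : ∀ {u v} → Adj E u v → Adj E v u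
  Adj-sym {u} {v} = trans (proj₁ (proj₁ tree) v u)

  Adj⇒≢ : ∀ {u v} → Adj E u v → u ≢ v
  Adj⇒≢ {u} u~u refl = proj₂ (proj₁ tree) u u~u

  OffEdge-sym : ∀ {v u s t} → OffEdge E v u s t → OffEdge E v u t s
  OffEdge-sym (s~t , ¬vu , ¬uv) = Adj-sym s~t , ¬uv ∘ swap , ¬vu ∘ swap

  OffEdge-flip : ∀ {v u s t} → OffEdge E v u s t → OffEdge E u v s t
  OffEdge-flip (s~t , ¬vu , ¬uv) = s~t , ¬uv , ¬vu

  Within-sym : ∀ {C s t} → Within E C s t → Within E C t s
  Within-sym (s~t , C-s , C-t) = Adj-sym s~t , C-t , C-s

  -- A walk from u back to a avoiding the edge au closes a cycle.
  dangling-∌-base : ∀ {a u} → Adj E a u → ¬ Dangling E a u a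
  dangling-∌-base {a} a~u walk with loop-erasure walk
  ... | [] , _ , _ , refl = Adj⇒≢ a~u refl
  ... | _ ∷ [] , _ , (u→a ∷ [-]) , refl = proj₂ (proj₂ u→a) (refl , refl)
  ... | qs@(_ ∷ _ ∷ _) , distinct , path , ends = proj₂ (proj₂ tree)
    ( a , qs , s≤s (s≤s z≤n) , distinct
    , ++⁺ (Linked.map (Adj-sym ∘ proj₁) path)
          (subst (λ end → ConnectedMaybe (Adj E) end (just a)) (sym ends) (just (Adj-sym a~u)))
          [-])

  dangling-step : ∀ {a u s t} → Adj E a u → Dangling E a u s → Adj E s t →
                  ¬ (s ≡ u × t ≡ a) → Dangling E a u t
  dangling-step a~u D-s s~t ¬ua =
    step D-s (s~t , (λ { (refl , _) → dangling-∌-base a~u D-s }) , ¬ua)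

  avoiding-path-walk : ∀ {x p y ys z} → Linked (Adj E) (y ∷ ys) → All (x ≢_) (y ∷ ys) →
                       z ∈ y ∷ ys → Reach E (OffEdge E x p) y z
  avoiding-path-walk _ _ (here refl) = here
  avoiding-path-walk (y~y′ ∷ path) (x≢y ∷ x∉@(x≢y′ ∷ _)) (there z∈) =
    Reach-cons (y~y′ , x≢y ∘ sym ∘ proj₁ , x≢y′ ∘ sym ∘ proj₂)
               (avoiding-path-walk path x∉ z∈)

  parent⇒dangling : ∀ {r x p} → Parent E r x p → Dangling E x p r
  parent⇒dangling ([] , _ , _ , refl) = here
  parent⇒dangling (w ∷ ws , (x∉ ∷ _) , (_ ∷ path) , refl) =
    avoiding-path-walk path x∉ (there (∈-++⁺ʳ ws (here refl)))

  parent-not-child : ∀ {r x p} → Adj E x p → Parent E r x p → ¬ Parent E r p x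
  parent-not-child x~p up down =
    dangling-∌-base x~p
      (Reach-trans (parent⇒dangling up)
                   (Reach-reverse OffEdge-sym (Reach-map OffEdge-flip (parent⇒dangling down))))

  module _ {x : Fin n} where

    hanging-step : ∀ {a s t} (b : Branch E x a) → Hanging b s → Adj E s t → t ≢ a → Hanging b t
    hanging-step b h s~t t≢a = dangling-step (base~tip b) h s~t (t≢a ∘ proj₂)

    x∉hanging : ∀ {a} (b : Branch E x a) → ¬ Hanging b x
    x∉hanging b h =
      dangling-∌-base (base~tip b) (dangling-step (base~tip b) h (x~base b) (tip≢x b ∘ sym ∘ proj₁))

    sibling∉hanging : ∀ {a a′} (b : Branch E x a) → Branch E x a′ → ¬ Hanging b a′
    sibling∉hanging b b′ h = x∉hanging b (hanging-step b h (Adj-sym (x~base b′)) (Adj⇒≢ (x~base b)))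

    hanging-disjoint : ∀ {a a′ s} (b : Branch E x a) (b′ : Branch E x a′) → a ≢ a′ →
                       Hanging b s → ¬ Hanging b′ s
    hanging-disjoint b b′ a≢a′ h h′ =
      sibling∉hanging b b′ (hanging-step b (tip′∈ h′ h) (Adj-sym (base~tip b′)) (a≢a′ ∘ sym))
      where
      tip′∈ : ∀ {s} → Hanging b′ s → Hanging b s → Hanging b (tip b′)
      tip′∈ here h = h
      tip′∈ (step w (t~s , _)) h =
        tip′∈ w (hanging-step b h (Adj-sym t~s) (λ { refl → sibling∉hanging b′ b w }))

    module _ {a a′ : Fin n} (b : Branch E x a) (b′ : Branch E x a′) (a≢a′ : a ≢ a′) where

      arm-∌-base : ∀ {t} → Arm b′ t → t ≢ a
      arm-∌-base (inj₁ refl) = Adj⇒≢ (x~base b)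
      arm-∌-base (inj₂ (inj₁ refl)) = a≢a′ ∘ sym
      arm-∌-base (inj₂ (inj₂ h′)) refl = sibling∉hanging b′ b h′

      arm-∉-hanging : ∀ {t} → Arm b′ t → ¬ Hanging b t
      arm-∉-hanging (inj₁ refl) = x∉hanging b
      arm-∉-hanging (inj₂ (inj₁ refl)) = sibling∉hanging b b′
      arm-∉-hanging (inj₂ (inj₂ h′)) h = hanging-disjoint b b′ a≢a′ h h′

      hanging-arm-nonadjacent : ∀ {s t} → Hanging b s → Arm b′ t → ¬ Adj E s t
      hanging-arm-nonadjacent h A s~t = arm-∉-hanging A (hanging-step b h s~t (arm-∌-base A))

    arm-walk : ∀ {a t} (b : Branch E x a) → Arm b t → Reach E (Within E (Arm b)) x t
    arm-walk b (inj₁ refl) = here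
    arm-walk b (inj₂ (inj₁ refl)) = step here (x~base b , inj₁ refl , inj₂ (inj₁ refl))
    arm-walk b (inj₂ (inj₂ h)) =
      Reach-trans
        (step (arm-walk b (inj₂ (inj₁ refl))) (base~tip b , inj₂ (inj₁ refl) , inj₂ (inj₂ here)))
        (Reach-map (Within-mono {E = E} (inj₂ ∘ inj₂)) (Reach-inside proj₁ h))

    arms-connected : ∀ {a a′ s t} (b : Branch E x a) (b′ : Branch E x a′) →
                     Arms b b′ s → Arms b b′ t → Reach E (Within E (Arms b b′)) s t
    arms-connected b b′ A B = Reach-trans (Reach-reverse Within-sym (from-x A)) (from-x B)
      where
      from-x : ∀ {t} → Arms b b′ t → Reach E (Within E (Arms b b′)) x t
      from-x (inj₁ A) = Reach-map (Within-mono {E = E} inj₁) (arm-walk b A)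
      from-x (inj₂ A) = Reach-map (Within-mono {E = E} inj₂) (arm-walk b′ A)

module _ (_≺_ : Fin n → Fin n → Set) where

  Between : (Fin n → Set) → Fin n → Set
  Between C v = (∃ λ s → C s × s ≺ v) × (∃ λ t → C t × v ≺ t)

  Middle : Fin n → Fin n → Fin n → Set
  Middle v s t = (s ≺ v × v ≺ t) ⊎ (t ≺ v × v ≺ s)

  middle-between : ∀ {C v s t} → Middle v s t → C s → C t → Between C v
  middle-between (inj₁ (s≺v , v≺t)) C-s C-t = (_ , C-s , s≺v) , (_ , C-t , v≺t)
  middle-between (inj₂ (t≺v , v≺s)) C-s C-t = (_ , C-t , t≺v) , (_ , C-s , v≺s)

Straddled : (E : Graph n) (_≺_ : Fin n → Fin n → Set) → (Fin n → Set) → Fin n → Set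
Straddled E _≺_ C v = ∃₂ λ p q → C p × C q × Adj E p q × p ≺ v × v ≺ q

module _ {E : Graph n} {_≺_ : Fin n → Fin n → Set} (sto : IsStrictTotalOrder _≡_ _≺_) where
  open IsStrictTotalOrder sto using (compare; asym)

  walk-straddles : ∀ {C v s t} → ¬ C v → Reach E (Within E C) s t → s ≺ v → v ≺ t →
                   Straddled E _≺_ C v
  walk-straddles v∉C here s≺v v≺s = ⊥-elim (asym s≺v v≺s)
  walk-straddles {v = v} v∉C (step {t′} w (t′~t , C-t′ , C-t)) s≺v v≺t with compare t′ v
  ... | tri< t′≺v _ _ = t′ , _ , C-t′ , C-t , t′~t , t′≺v , v≺t
  ... | tri≈ _ refl _ = ⊥-elim (v∉C C-t′)
  ... | tri> _ _ v≺t′ = walk-straddles v∉C w s≺v v≺t′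

  between-straddled : ∀ {C v} → (∀ {s t} → C s → C t → Reach E (Within E C) s t) →
                      ¬ C v → Between _≺_ C v → Straddled E _≺_ C v
  between-straddled connected v∉C ((s , C-s , s≺v) , (t , C-t , v≺t)) =
    walk-straddles v∉C (connected C-s C-t) s≺v v≺t

module _ {_≺_ : Fin n → Fin n → Set} (sto : IsStrictTotalOrder _≡_ _≺_) where
  open IsStrictTotalOrder sto using (compare)

  one-in-middle : ∀ {a b c} → a ≢ b → a ≢ c → b ≢ c →
                  Middle _≺_ a b c ⊎ Middle _≺_ b a c ⊎ Middle _≺_ c a b
  one-in-middle {a} {b} {c} a≢b a≢c b≢c with compare a b | compare b c | compare a c
  ... | tri≈ _ a≡b _ | _ | _ = ⊥-elim (a≢b a≡b)
  ... | _ | tri≈ _ b≡c _ | _ = ⊥-elim (b≢c b≡c)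
  ... | _ | _ | tri≈ _ a≡c _ = ⊥-elim (a≢c a≡c)
  ... | tri< a≺b _ _ | tri< b≺c _ _ | _ = inj₂ (inj₁ (inj₁ (a≺b , b≺c)))
  ... | tri< a≺b _ _ | tri> _ _ c≺b | tri< a≺c _ _ = inj₂ (inj₂ (inj₁ (a≺c , c≺b)))
  ... | tri< a≺b _ _ | tri> _ _ c≺b | tri> _ _ c≺a = inj₁ (inj₂ (c≺a , a≺b))
  ... | tri> _ _ b≺a | tri< b≺c _ _ | tri< a≺c _ _ = inj₁ (inj₁ (b≺a , a≺c))
  ... | tri> _ _ b≺a | tri< b≺c _ _ | tri> _ _ c≺a = inj₂ (inj₂ (inj₂ (b≺c , c≺a)))
  ... | tri> _ _ b≺a | tri> _ _ c≺b | _ = inj₂ (inj₁ (inj₂ (c≺b , b≺a)))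

module StraddledSubgraph
  {E : Graph n} (E-sym : ∀ u v → E u v ≡ E v u)
  {_≺_ : Fin n → Fin n → Set} (sto : IsStrictTotalOrder _≡_ _≺_)
  {K : ℕ} (c : Fin n → Fin (suc K))
  (consistent : ∀ u v w → u ≺ v → v ≺ w → c u ≡ c v → Adj E u w → Adj E v w)
  {H C : Fin n → Set} (H? : Decidable H)
  (H∩C=∅ : ∀ {v} → H v → ¬ C v)
  (H-C-nonadjacent : ∀ {s t} → H s → C t → ¬ Adj E s t)
  (straddled : ∀ {v} → H v → Straddled E _≺_ C v)
  {h₀ : Fin n} (h₀∈H : H h₀)
  where

  open IsStrictTotalOrder sto using (compare; _<?_) renaming (trans to ≺-trans; irrefl to ≺-irrefl)

  private
    Adj-sym : ∀ {u v} → Adj E u v → Adj E v u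
    Adj-sym {u} {v} = trans (E-sym v u)

    Adj? : ∀ u v → Dec (Adj E u v)
    Adj? u v = E u v Bool.≟ true

  -- Only such pairs can violate the thinness condition for a partition of H.
  Jumps : Fin n → Fin n → Set
  Jumps u v = H u × u ≺ v × ∃ λ w → H w × v ≺ w × Adj E u w

  Jumps? : ∀ u v → Dec (Jumps u v)
  Jumps? u v = H? u ×-dec u <? v ×-dec any? (λ w → H? w ×-dec v <? w ×-dec Adj? u w)

  Jumps-shorten : ∀ {u v v′} → v′ ≺ v → Jumps u v → u ≺ v′ → Jumps u v′
  Jumps-shorten v′≺v (H-u , _ , w , H-w , v≺w , u~w) u≺v′ =
    H-u , u≺v′ , w , H-w , ≺-trans v′≺v v≺w , u~w

  avoided-class : ∀ {v} → H v → ∃ λ a → a ≢ c v × (∀ {u} → Jumps u v → c u ≢ a)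
  avoided-class {v} H-v with straddled H-v
  ... | p , q , C-p , C-q , p~q , p≺v , v≺q = c p , p≁v , jumper≁p
    where
    p≁v : c p ≢ c v
    p≁v same = H-C-nonadjacent H-v C-q (consistent _ _ _ p≺v v≺q same p~q)

    jumper≁p : ∀ {u} → Jumps u v → c u ≢ c p
    jumper≁p {u} (H-u , u≺v , w , H-w , v≺w , u~w) same with compare u p
    ... | tri< u≺p _ _ =
      H-C-nonadjacent H-w C-p (Adj-sym (consistent _ _ _ u≺p (≺-trans p≺v v≺w) same u~w))
    ... | tri≈ _ refl _ = H∩C=∅ H-u C-p
    ... | tri> _ _ p≺u =
      H-C-nonadjacent H-u C-q (consistent _ _ _ p≺u (≺-trans u≺v v≺q) (sym same) p~q)

  -- A labelling c′ with K labels is built greedily along ≺ by merging classes of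
  -- c, never merging the classes of a pair u, v with Jumps u v.
  FaithfulAt : (Fin n → Fin K) → Fin n → Fin K → Set
  FaithfulAt c′ v ℓ = ∀ {u} → Jumps u v → c′ u ≡ ℓ ⇔ c u ≡ c v

  Faithful : (Fin n → Fin K) → Fin n → Set
  Faithful c′ v = FaithfulAt c′ v (c′ v)

  faithful-update : ∀ {c₁ c₂ v ℓ} → (∀ {u} → u ≺ v → c₂ u ≡ c₁ u) → c₂ v ≡ ℓ →
                    FaithfulAt c₁ v ℓ → Faithful c₂ v
  faithful-update agree refl faithful J@(_ , u≺v , _) rewrite agree u≺v = faithful J

  rank : Fin n → ℕ
  rank v = count (_<? v)

  rank-mono : ∀ {u v} → u ≺ v → rank u < rank v
  rank-mono u≺v = count-< (_<? _) (_<? _) (λ t≺u → ≺-trans t≺u u≺v) (≺-irrefl refl) u≺v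

  rank-injective : ∀ {u v} → rank u ≡ rank v → u ≡ v
  rank-injective {u} {v} same with compare u v
  ... | tri< u≺v _ _ = ⊥-elim (ℕ.<⇒≢ (rank-mono u≺v) same)
  ... | tri≈ _ u≡v _ = u≡v
  ... | tri> _ _ v≺u = ⊥-elim (ℕ.<⇒≢ (rank-mono v≺u) (sym same))

  FaithfulBelow : (Fin n → Fin K) → ℕ → Set
  FaithfulBelow c′ m = ∀ {v} → H v → rank v < m → Faithful c′ v

  module NextVertex {m : ℕ} {c′ : Fin n → Fin K} (faithful : FaithfulBelow c′ m)
                    {v₀ : Fin n} (H-v₀ : H v₀) (rank-v₀ : rank v₀ ≡ m) where

    earlier-faithful : ∀ {u} → u ≺ v₀ → H u → Faithful c′ u
    earlier-faithful u≺v₀ H-u = faithful H-u (subst (rank _ <_) rank-v₀ (rank-mono u≺v₀))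

    jumpers-coherent : ∀ {u u′} → Jumps u v₀ → Jumps u′ v₀ → c′ u ≡ c′ u′ ⇔ c u ≡ c u′
    jumpers-coherent {u} {u′} J@(H-u , u≺v₀ , _) J′@(H-u′ , u′≺v₀ , _) with compare u u′
    ... | tri< u≺u′ _ _ = earlier-faithful u′≺v₀ H-u′ (Jumps-shorten u′≺v₀ J u≺u′)
    ... | tri≈ _ refl _ = mk⇔ (λ _ → refl) (λ _ → refl)
    ... | tri> _ _ u′≺u = ≡-sym-⇔ (earlier-faithful u≺v₀ H-u (Jumps-shorten u≺v₀ J′ u′≺u))

    -- The labels used by jumpers of v₀ correspond injectively to classes other
    -- than c v₀ and the avoided class, so fewer than K of the K labels are used.
    free-label : (∀ {u} → Jumps u v₀ → c u ≢ c v₀) → ∃ λ ℓ → ∀ {u} → Jumps u v₀ → c′ u ≢ ℓ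
    free-label none-shares with any? (λ ℓ → ¬? (any? (λ u → Jumps? u v₀ ×-dec c′ u ≟ ℓ)))
    ... | yes (ℓ , unused) = ℓ , λ J used → unused (_ , J , used)
    ... | no all-used =
      ⊥-elim (no-injection-avoiding-two (c ∘ jumper) jumper-injective
                (proj₁ (proj₂ (avoided-class H-v₀)))
                (λ ℓ → proj₂ (proj₂ (avoided-class H-v₀)) (jumper-jumps ℓ))
                (λ ℓ → none-shares (jumper-jumps ℓ)))
      where
      user : ∀ ℓ → ∃ λ u → Jumps u v₀ × c′ u ≡ ℓ
      user ℓ = decidable-stable (any? (λ u → Jumps? u v₀ ×-dec c′ u ≟ ℓ))
                                (λ unused → all-used (ℓ , unused))

      jumper : Fin K → Fin n
      jumper ℓ = proj₁ (user ℓ)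

      jumper-jumps : ∀ ℓ → Jumps (jumper ℓ) v₀
      jumper-jumps ℓ = proj₁ (proj₂ (user ℓ))

      jumper-label : ∀ ℓ → c′ (jumper ℓ) ≡ ℓ
      jumper-label ℓ = proj₂ (proj₂ (user ℓ))

      jumper-injective : Injective _≡_ _≡_ (c ∘ jumper)
      jumper-injective {ℓ} {ℓ′} same =
        trans (sym (jumper-label ℓ))
              (trans (from (jumpers-coherent (jumper-jumps ℓ) (jumper-jumps ℓ′)) same)
                     (jumper-label ℓ′))

    label : ∃ (FaithfulAt c′ v₀)
    label with any? (λ u → Jumps? u v₀ ×-dec c u ≟ c v₀)
    ... | yes (u₀ , J₀ , same) = c′ u₀ , λ J →
      mk⇔ (λ e → trans (to (jumpers-coherent J J₀) e) same)
          (λ e → from (jumpers-coherent J J₀) (trans e (sym same)))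
    ... | no none = let (ℓ , free) = free-label (λ J same → none (_ , J , same)) in
      ℓ , λ J → mk⇔ (⊥-elim ∘ free J) (λ same → ⊥-elim (none (_ , J , same)))

    extended : FaithfulBelow (updateAt c′ v₀ (const (proj₁ label))) (suc m)
    extended {v} H-v rank<1+m with ℕ.m<1+n⇒m<n∨m≡n rank<1+m
    ... | inj₁ rank<m =
      faithful-update (λ u≺v → updateAt-minimal _ _ c′ (≢v₀ (ℕ.<-trans (rank-mono u≺v) rank<m)))
                      (updateAt-minimal _ _ c′ (≢v₀ rank<m))
                      (faithful H-v rank<m)
      where
      ≢v₀ : ∀ {u} → rank u < m → u ≢ v₀
      ≢v₀ r refl = ℕ.<⇒≢ r rank-v₀
    ... | inj₂ rank≡m with rank-injective (trans rank≡m (sym rank-v₀))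
    ... | refl =
      faithful-update (λ u≺v₀ → updateAt-minimal _ _ c′ (λ { refl → ≺-irrefl refl u≺v₀ }))
                      (updateAt-updates v₀ c′)
                      (proj₂ label)

  faithful-labelling : ∀ m → ∃ λ c′ → FaithfulBelow c′ m
  faithful-labelling zero = const (punchOut (proj₁ (proj₂ (avoided-class h₀∈H)))) , λ _ ()
  faithful-labelling (suc m) with faithful-labelling m
  ... | c′ , faithful with any? (λ v → H? v ×-dec rank v ℕ.≟ m)
  ... | yes (v₀ , H-v₀ , rank-v₀) = _ , NextVertex.extended faithful H-v₀ rank-v₀
  ... | no none = c′ , λ H-v rank<1+m →
    faithful H-v (ℕ.≤∧≢⇒< (s≤s⁻¹ rank<1+m) λ rank≡m → none (_ , H-v , rank≡m))

  straddled-KThin : KThin E H K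
  straddled-KThin with faithful-labelling (suc n)
  ... | c′ , faithful = _≺_ , sto , c′ , λ u v w H-u H-v H-w u≺v v≺w same u~w →
    consistent u v w u≺v v≺w
      (to (faithful H-v (s≤s (count≤ _)) (H-u , u≺v , w , H-w , v≺w , u~w)) same)
      u~w

module HeavyBranches {n : ℕ} {E : Graph n} (tree : IsTree E) {K : ℕ}
                     (thin : KThin E (AllV E) (suc K)) {x : Fin n} where
  open Tree tree

  private
    _≺_ : Fin n → Fin n → Set
    _≺_ = proj₁ thin

    sto : IsStrictTotalOrder _≡_ _≺_
    sto = proj₁ (proj₂ thin)

    c : Fin n → Fin (suc K)
    c = proj₁ (proj₂ (proj₂ thin))

    consistent : ∀ u v w → u ≺ v → v ≺ w → c u ≡ c v → Adj E u w → Adj E v w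
    consistent u v w = proj₂ (proj₂ (proj₂ thin)) u v w tt tt tt

  exposed-vertex : ∀ {a a′ a″} (b : Branch E x a) (b′ : Branch E x a′) (b″ : Branch E x a″) →
                   a ≢ a′ → a ≢ a″ → ThinGe E (Hanging b) (suc K) →
                   ¬ ¬ ∃ λ v → Hanging b v × ¬ Between _≺_ (Arms b′ b″) v
  -- The goal is ⊥, so membership in Hanging b and Between may be decided classically.
  exposed-vertex b b′ b″ a≢a′ a≢a″ heavy ¬exposed =
    ¬¬-decidable (Hanging b) λ H? →
    ¬¬-decidable (Between _≺_ (Arms b′ b″)) λ Between? →
    heavy K (ℕ.n<1+n K)
      (StraddledSubgraph.straddled-KThin (proj₁ (proj₁ tree)) sto c consistent H?
        disjoint nonadjacent (straddle Between?) (here {u = tip b}))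
    where
    disjoint : ∀ {v} → Hanging b v → ¬ Arms b′ b″ v
    disjoint h (inj₁ A) = arm-∉-hanging b b′ a≢a′ A h
    disjoint h (inj₂ A) = arm-∉-hanging b b″ a≢a″ A h

    nonadjacent : ∀ {s t} → Hanging b s → Arms b′ b″ t → ¬ Adj E s t
    nonadjacent h (inj₁ A) = hanging-arm-nonadjacent b b′ a≢a′ h A
    nonadjacent h (inj₂ A) = hanging-arm-nonadjacent b b″ a≢a″ h A

    straddle : Decidable (Between _≺_ (Arms b′ b″)) →
               ∀ {v} → Hanging b v → Straddled E _≺_ (Arms b′ b″) v
    straddle Between? {v} h with Between? v
    ... | yes between = between-straddled sto (arms-connected b′ b″) (disjoint h) between
    ... | no ¬between = ⊥-elim (¬exposed (v , h , ¬between))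

  three-heavy-branches : ∀ {a₁ a₂ a₃}
                         (b₁ : Branch E x a₁) (b₂ : Branch E x a₂) (b₃ : Branch E x a₃) →
                         a₁ ≢ a₂ → a₁ ≢ a₃ → a₂ ≢ a₃ →
                         ThinGe E (Hanging b₁) (suc K) → ThinGe E (Hanging b₂) (suc K) →
                         ThinGe E (Hanging b₃) (suc K) → ⊥
  three-heavy-branches b₁ b₂ b₃ a₁≢a₂ a₁≢a₃ a₂≢a₃ heavy₁ heavy₂ heavy₃ =
    exposed-vertex b₁ b₂ b₃ a₁≢a₂ a₁≢a₃ heavy₁ λ (v₁ , h₁ , ¬between₁) →
    exposed-vertex b₂ b₁ b₃ (a₁≢a₂ ∘ sym) a₂≢a₃ heavy₂ λ (v₂ , h₂ , ¬between₂) →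
    exposed-vertex b₃ b₁ b₂ (a₁≢a₃ ∘ sym) (a₂≢a₃ ∘ sym) heavy₃ λ (v₃ , h₃ , ¬between₃) →
    case one-in-middle sto (distinct b₁ b₂ a₁≢a₂ h₁ h₂) (distinct b₁ b₃ a₁≢a₃ h₁ h₃)
                           (distinct b₂ b₃ a₂≢a₃ h₂ h₃) of λ where
      (inj₁ middle₁) →
        ¬between₁ (middle-between _≺_ middle₁ (inj₁ (arm b₂ h₂)) (inj₂ (arm b₃ h₃)))
      (inj₂ (inj₁ middle₂)) →
        ¬between₂ (middle-between _≺_ middle₂ (inj₁ (arm b₁ h₁)) (inj₂ (arm b₃ h₃)))
      (inj₂ (inj₂ middle₃)) →
        ¬between₃ (middle-between _≺_ middle₃ (inj₁ (arm b₁ h₁)) (inj₂ (arm b₂ h₂)))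
    where
    arm : ∀ {a t} (b : Branch E x a) → Hanging b t → Arm b t
    arm b = inj₂ ∘ inj₂

    distinct : ∀ {a a′ v v′} (b : Branch E x a) (b′ : Branch E x a′) → a ≢ a′ →
               Hanging b v → Hanging b′ v′ → v ≢ v′
    distinct b b′ a≢a′ h h′ refl = hanging-disjoint b b′ a≢a′ h h′

mainTheorem14 : (n : ℕ) (E : Graph n) → IsTree E → (r : Fin n) (k : ℕ) →
    ThinEq E (AllV E) k → (x p : Fin n) → Critical E r k x →
    Parent E r x p → ¬ KNeighbor E k x p
mainTheorem14 n E tree r zero ((_ , _ , c , _) , _) x p _ _ _ = ¬Fin0 (c x)
mainTheorem14 n E tree r (suc K) (thin , _) x p
  (c₁ , c₂ , c₁≢c₂ , c₁-child , (x~c₁ , u₁ , c₁~u₁ , u₁≢x , heavy₁)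
                   , c₂-child , (x~c₂ , u₂ , c₂~u₂ , u₂≢x , heavy₂) , _)
  x-parent (x~p , u , p~u , u≢x , heavy) =
  HeavyBranches.three-heavy-branches tree thin
    (branch u₁ x~c₁ c₁~u₁ u₁≢x) (branch u₂ x~c₂ c₂~u₂ u₂≢x) (branch u x~p p~u u≢x)
    c₁≢c₂ (child≢parent c₁-child) (child≢parent c₂-child) heavy₁ heavy₂ heavy
  where
  open Tree tree

  child≢parent : ∀ {c} → Child E r x c → c ≢ p
  child≢parent child refl = parent-not-child x~p x-parent child
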